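{- Let $m\ge 2$. For any $\pi\in S_m$, $$\sum_{i,j=1}^{m}[i,j]_{m}\,[\pi(i),\pi(j)]_{m}>\binom{2m-1}{m-1}^2.$$
   Context: For integers $1\le i,j\le m$, $[i,j]_m=\binom{i-1+j-1}{i-1}\binom{m-i+m-j}{m-i}$. -}

module Defs where

open import Data.Nat using (ℕ; _+_; _*_; _∸_)
open import Data.Nat.Combinatorics using (_C_)
open import Data.Fin using (Fin; toℕ; zero; suc)
open import Data.Fin.Permutation using (Permutation′; _⟨$⟩ʳ_)

Σ[<_]_ : (n : ℕ) → (Fin n → ℕ) → ℕ
Σ[< ℕ.zero ] f = 0
Σ[< ℕ.suc n ] f = f zero + Σ[< n ] (λ i → f (suc i))

-- Indices 1..m are represented by Fin m, with i ↦ toℕ i + 1.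
-- So i-1 = toℕ i and m-i = m ∸ 1 ∸ toℕ i.
-- [i,j]_m = C(i-1+j-1, i-1) * C(m-i+m-j, m-i)
bracket : (m : ℕ) → Fin m → Fin m → ℕ
bracket m i j =
  ((toℕ i + toℕ j) C toℕ i) * (((m ∸ ℕ.suc (toℕ i)) + (m ∸ ℕ.suc (toℕ j))) C (m ∸ ℕ.suc (toℕ i)))

permSum : (m : ℕ) → Permutation′ m → ℕ
permSum m π = Σ[< m ] (λ i → Σ[< m ] (λ j → bracket m i j * bracket m (π ⟨$⟩ʳ i) (π ⟨$⟩ʳ j)))

-- Shift indices to start at 0 and write m = n + 1.  Vandermonde's identity in each factor
-- gives [i,j] = Σ_{k,l} M_i(k,l) M_j(k,l) for M_i(k,l) = C(i,k) C(n-i,l), so the bracket matrix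
-- is the Gram matrix M Mᵀ and the sum to be bounded is ‖Mᵀ P M‖², P the matrix of π.
-- The column sums a = Mᵀ 1, a(k,l) = C(m,k+l+1), satisfy M a = N 1 with N = C(2m-1,m-1);
-- hence ⟨Mᵀ P M, a aᵀ⟩ = m N² and ‖a aᵀ‖² = (m N)², and expanding the square gives
-- m² (‖Mᵀ P M‖² - N²) = ‖m Mᵀ P M - a aᵀ‖².  This is positive: at the diagonal entry indexed by
-- (0,n) the matrix a aᵀ is 1, which is not a multiple of m ≥ 2.
module Submission where

open import Defs
open import Data.Fin using (Fin; toℕ; zero; suc; fromℕ)
open import Data.Fin.Permutation using (Permutation′; _⟨$⟩ʳ_)
open import Data.Fin.Properties using (toℕ<n; toℕ≤pred[n]; toℕ-fromℕ)
open import Data.List using ([]; _∷_)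
open import Data.Nat using (ℕ; zero; suc; _+_; _*_; _∸_; _≤_; _<_; s≤s; ∣_-_∣)
open import Data.Nat.Combinatorics using (_C_; nCk+nC[k+1]≡[n+1]C[k+1]; nCk≡nC[n∸k]; nCn≡1)
open import Data.Nat.Properties
open import Data.Nat.Tactic.RingSolver using (solve)
open import Data.Product using (_×_; _,_)
open import Data.Sum using ([_,_]′)
open import Function using (_∘_)
open import Relation.Binary.PropositionalEquality
open import Algebra.Properties.CommutativeSemigroup *-commutativeSemigroup using (interchange)
open import Algebra.Properties.Semiring.Sum +-*-semiring
  using ( sum; sum-syntax; sum-cong-≗; sum-replicate-zero; ∑-distrib-+; ∑-comm
        ; *-distribˡ-sum; *-distribʳ-sum)

open ≡-Reasoning

m*m+n*n≡∣m-n∣*∣m-n∣+2*[m*n] : ∀ m n → m * m + n * n ≡ ∣ m - n ∣ * ∣ m - n ∣ + 2 * (m * n)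
m*m+n*n≡∣m-n∣*∣m-n∣+2*[m*n] m n = [ ≤-case , ≥-case ]′ (≤-total m n)
  where
  ≤-case : ∀ {m n} → m ≤ n → m * m + n * n ≡ ∣ m - n ∣ * ∣ m - n ∣ + 2 * (m * n)
  ≤-case {m} m≤n with m≤n⇒∃[o]m+o≡n m≤n
  ... | k , refl = begin
    m * m + (m + k) * (m + k)
      ≡⟨ solve (m ∷ k ∷ []) ⟩
    k * k + 2 * (m * (m + k))
      ≡⟨ cong (λ d → d * d + 2 * (m * (m + k))) (∣m-m+n∣≡n m k) ⟨
    ∣ m - m + k ∣ * ∣ m - m + k ∣ + 2 * (m * (m + k)) ∎
  ≥-case : n ≤ m → m * m + n * n ≡ ∣ m - n ∣ * ∣ m - n ∣ + 2 * (m * n)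
  ≥-case n≤m = begin
    m * m + n * n
      ≡⟨ +-comm (m * m) (n * n) ⟩
    n * n + m * m
      ≡⟨ ≤-case n≤m ⟩
    ∣ n - m ∣ * ∣ n - m ∣ + 2 * (n * m)
      ≡⟨ cong₂ (λ d e → d * d + 2 * e) (∣-∣-comm n m) (*-comm n m) ⟩
    ∣ m - n ∣ * ∣ m - n ∣ + 2 * (m * n) ∎

m≢n⇒0<∣m-n∣*∣m-n∣ : ∀ {m n} → m ≢ n → 0 < ∣ m - n ∣ * ∣ m - n ∣
m≢n⇒0<∣m-n∣*∣m-n∣ m≢n = *-mono-< 0<∣m-n∣ 0<∣m-n∣
  where 0<∣m-n∣ = n≢0⇒n>0 (m≢n ∘ ∣m-n∣≡0⇒m≡n)

Σ[<]≡sum : ∀ n (f : Fin n → ℕ) → Σ[< n ] f ≡ sum f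
Σ[<]≡sum zero    f = refl
Σ[<]≡sum (suc n) f = cong (f zero +_) (Σ[<]≡sum n (f ∘ suc))

∑-const : ∀ n c → ∑[ i < n ] c ≡ n * c
∑-const zero    c = refl
∑-const (suc n) c = cong (c +_) (∑-const n c)

≤-sum : ∀ {n} (f : Fin n → ℕ) i → f i ≤ sum f
≤-sum f zero    = m≤m+n (f zero) _
≤-sum f (suc i) = ≤-trans (≤-sum (f ∘ suc) i) (m≤n+m _ (f zero))

sum-*-sum : ∀ {n k} (f : Fin n → ℕ) (g : Fin k → ℕ) → sum f * sum g ≡ ∑[ i < n ] ∑[ j < k ] (f i * g j)
sum-*-sum f g = trans (*-distribʳ-sum (sum g) f) (sum-cong-≗ λ i → *-distribˡ-sum (f i) g)

module _ {r s : ℕ} where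

  sum× : (Fin r × Fin s → ℕ) → ℕ
  sum× f = ∑[ k < r ] ∑[ l < s ] f (k , l)

  sum×-cong : ∀ {f g : Fin r × Fin s → ℕ} → (∀ u → f u ≡ g u) → sum× f ≡ sum× g
  sum×-cong f≗g = sum-cong-≗ λ k → sum-cong-≗ λ l → f≗g (k , l)

  sum×-distrib-+ : ∀ (f g : Fin r × Fin s → ℕ) → sum× (λ u → f u + g u) ≡ sum× f + sum× g
  sum×-distrib-+ f g =
    trans (sum-cong-≗ λ k → ∑-distrib-+ (λ l → f (k , l)) (λ l → g (k , l)))
          (∑-distrib-+ (λ k → ∑[ l < s ] f (k , l)) _)

  *-distribˡ-sum× : ∀ c (f : Fin r × Fin s → ℕ) → c * sum× f ≡ sum× (λ u → c * f u)
  *-distribˡ-sum× c f = trans (*-distribˡ-sum c λ k → ∑[ l < s ] f (k , l))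
                              (sum-cong-≗ λ k → *-distribˡ-sum c λ l → f (k , l))

  *-distribʳ-sum× : ∀ c (f : Fin r × Fin s → ℕ) → sum× f * c ≡ sum× (λ u → f u * c)
  *-distribʳ-sum× c f = trans (*-distribʳ-sum c λ k → ∑[ l < s ] f (k , l))
                              (sum-cong-≗ λ k → *-distribʳ-sum c λ l → f (k , l))

  sum×-comm : ∀ {m} (f : Fin r × Fin s → Fin m → ℕ) →
              sum× (λ u → ∑[ i < m ] f u i) ≡ ∑[ i < m ] sum× (λ u → f u i)
  sum×-comm f = trans (sum-cong-≗ λ k → ∑-comm λ l → f (k , l)) (∑-comm λ k i → ∑[ l < s ] f (k , l) i)

  ≤-sum× : ∀ (f : Fin r × Fin s → ℕ) u → f u ≤ sum× f
  ≤-sum× f (k , l) = ≤-trans (≤-sum _ l) (≤-sum _ k)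

  sum×² : (Fin r × Fin s → Fin r × Fin s → ℕ) → ℕ
  sum×² F = sum× λ u → sum× λ v → F u v

  sum×²-cong : ∀ {F G : Fin r × Fin s → Fin r × Fin s → ℕ} →
               (∀ u v → F u v ≡ G u v) → sum×² F ≡ sum×² G
  sum×²-cong F≗G = sum×-cong λ u → sum×-cong λ v → F≗G u v

  sum×²-distrib-+ : ∀ (F G : Fin r × Fin s → Fin r × Fin s → ℕ) →
                    sum×² (λ u v → F u v + G u v) ≡ sum×² F + sum×² G
  sum×²-distrib-+ F G =
    trans (sum×-cong λ u → sum×-distrib-+ (F u) (G u)) (sum×-distrib-+ (λ u → sum× (F u)) _)

  *-distribˡ-sum×² : ∀ c (F : Fin r × Fin s → Fin r × Fin s → ℕ) →
                     c * sum×² F ≡ sum×² (λ u v → c * F u v)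
  *-distribˡ-sum×² c F =
    trans (*-distribˡ-sum× c (λ u → sum× (F u))) (sum×-cong λ u → *-distribˡ-sum× c (F u))

  ∑-sum×²-comm : ∀ {m} (F : Fin m → Fin r × Fin s → Fin r × Fin s → ℕ) →
                 ∑[ i < m ] sum×² (F i) ≡ sum×² (λ u v → ∑[ i < m ] F i u v)
  ∑-sum×²-comm F =
    sym (trans (sum×-cong λ u → sum×-comm λ v i → F i u v) (sum×-comm λ u i → sum× (F i u)))

  ≤-sum×² : ∀ (F : Fin r × Fin s → Fin r × Fin s → ℕ) u v → F u v ≤ sum×² F
  ≤-sum×² F u v = ≤-trans (≤-sum× (F u) v) (≤-sum× _ u)

  sum×-*-sum× : ∀ (f g : Fin r × Fin s → ℕ) → sum× f * sum× g ≡ sum×² (λ u v → f u * g v)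
  sum×-*-sum× f g = trans (*-distribʳ-sum× (sum× g) f) (sum×-cong λ u → *-distribˡ-sum× (f u) g)

  sum×²-squares : ∀ (x y : Fin r × Fin s → Fin r × Fin s → ℕ) →
                  sum×² (λ u v → x u v * x u v) + sum×² (λ u v → y u v * y u v) ≡
                  sum×² (λ u v → ∣ x u v - y u v ∣ * ∣ x u v - y u v ∣) + 2 * sum×² (λ u v → x u v * y u v)
  sum×²-squares x y = begin
    sum×² (λ u v → x u v * x u v) + sum×² (λ u v → y u v * y u v)
      ≡⟨ sum×²-distrib-+ (λ u v → x u v * x u v) (λ u v → y u v * y u v) ⟨
    sum×² (λ u v → x u v * x u v + y u v * y u v)
      ≡⟨ sum×²-cong (λ u v → m*m+n*n≡∣m-n∣*∣m-n∣+2*[m*n] (x u v) (y u v)) ⟩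
    sum×² (λ u v → ∣ x u v - y u v ∣ * ∣ x u v - y u v ∣ + 2 * (x u v * y u v))
      ≡⟨ sum×²-distrib-+ (λ u v → ∣ x u v - y u v ∣ * ∣ x u v - y u v ∣) (λ u v → 2 * (x u v * y u v)) ⟩
    sum×² (λ u v → ∣ x u v - y u v ∣ * ∣ x u v - y u v ∣) + sum×² (λ u v → 2 * (x u v * y u v))
      ≡⟨ cong (sum×² (λ u v → ∣ x u v - y u v ∣ * ∣ x u v - y u v ∣) +_)
              (*-distribˡ-sum×² 2 (λ u v → x u v * y u v)) ⟨
    sum×² (λ u v → ∣ x u v - y u v ∣ * ∣ x u v - y u v ∣) + 2 * sum×² (λ u v → x u v * y u v) ∎

module Gram {m r s : ℕ} (M : Fin m → Fin r × Fin s → ℕ) where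

  gram : Fin m → Fin m → ℕ
  gram i j = sum× λ u → M i u * M j u

  twistedGramSum : (Fin m → Fin m) → ℕ
  twistedGramSum p = ∑[ i < m ] ∑[ j < m ] (gram i j * gram (p i) (p j))

  twisted : (Fin m → Fin m) → Fin r × Fin s → Fin r × Fin s → ℕ
  twisted p u v = ∑[ i < m ] (M i u * M (p i) v)

  twistedGramSum≡sum×²twisted² : ∀ p → twistedGramSum p ≡ sum×² (λ u v → twisted p u v * twisted p u v)
  twistedGramSum≡sum×²twisted² p = begin
    ∑[ i < m ] ∑[ j < m ] (gram i j * gram (p i) (p j))
      ≡⟨ sum-cong-≗ (λ i → sum-cong-≗ λ j →
           trans (sum×-*-sum× (λ u → M i u * M j u) (λ v → M (p i) v * M (p j) v))
                 (sum×²-cong λ u v → interchange (M i u) (M j u) (M (p i) v) (M (p j) v))) ⟩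
    ∑[ i < m ] ∑[ j < m ] sum×² (λ u v → F i j u v)
      ≡⟨ sum-cong-≗ (λ i → ∑-sum×²-comm (F i)) ⟩
    ∑[ i < m ] sum×² (λ u v → ∑[ j < m ] F i j u v)
      ≡⟨ ∑-sum×²-comm (λ i u v → ∑[ j < m ] F i j u v) ⟩
    sum×² (λ u v → ∑[ i < m ] ∑[ j < m ] F i j u v)
      ≡⟨ sum×²-cong (λ u v → sum-*-sum (λ i → M i u * M (p i) v) (λ j → M j u * M (p j) v)) ⟨
    sum×² (λ u v → twisted p u v * twisted p u v) ∎
    where
    F : Fin m → Fin m → Fin r × Fin s → Fin r × Fin s → ℕ
    F i j u v = (M i u * M (p i) v) * (M j u * M (p j) v)

  module _ (a : Fin r × Fin s → ℕ) (N : ℕ)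
           (colSum : ∀ u → ∑[ j < m ] M j u ≡ a u)
           (rowDot : ∀ i → sum× (λ u → M i u * a u) ≡ N) where

    sum×a²≡m*N : sum× (λ u → a u * a u) ≡ m * N
    sum×a²≡m*N = begin
      sum× (λ u → a u * a u)
        ≡⟨ sum×-cong (λ u → trans (cong (_* a u) (sym (colSum u))) (*-distribʳ-sum (a u) λ j → M j u)) ⟩
      sum× (λ u → ∑[ j < m ] (M j u * a u))
        ≡⟨ sum×-comm (λ u j → M j u * a u) ⟩
      ∑[ j < m ] sum× (λ u → M j u * a u)
        ≡⟨ sum-cong-≗ rowDot ⟩
      ∑[ j < m ] N
        ≡⟨ ∑-const m N ⟩
      m * N ∎

    sum×²twisted*aa≡m*N² : ∀ p → sum×² (λ u v → twisted p u v * (a u * a v)) ≡ m * (N * N)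
    sum×²twisted*aa≡m*N² p = begin
      sum×² (λ u v → twisted p u v * (a u * a v))
        ≡⟨ sum×²-cong (λ u v → trans (*-distribʳ-sum (a u * a v) λ i → M i u * M (p i) v)
                                      (sum-cong-≗ λ i → interchange (M i u) (M (p i) v) (a u) (a v))) ⟩
      sum×² (λ u v → ∑[ i < m ] ((M i u * a u) * (M (p i) v * a v)))
        ≡⟨ ∑-sum×²-comm (λ i u v → (M i u * a u) * (M (p i) v * a v)) ⟨
      ∑[ i < m ] sum×² (λ u v → (M i u * a u) * (M (p i) v * a v))
        ≡⟨ sum-cong-≗ (λ i → trans (sym (sum×-*-sum× (λ u → M i u * a u) (λ v → M (p i) v * a v)))
                                   (cong₂ _*_ (rowDot i) (rowDot (p i)))) ⟩
      ∑[ i < m ] (N * N)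
        ≡⟨ ∑-const m (N * N) ⟩
      m * (N * N) ∎

    sum×²[m*twisted]²≡m*m*twistedGramSum : ∀ p →
      sum×² (λ u v → (m * twisted p u v) * (m * twisted p u v)) ≡ m * m * twistedGramSum p
    sum×²[m*twisted]²≡m*m*twistedGramSum p = begin
      sum×² (λ u v → (m * twisted p u v) * (m * twisted p u v))
        ≡⟨ sum×²-cong (λ u v → interchange m (twisted p u v) m (twisted p u v)) ⟩
      sum×² (λ u v → m * m * (twisted p u v * twisted p u v))
        ≡⟨ *-distribˡ-sum×² (m * m) (λ u v → twisted p u v * twisted p u v) ⟨
      m * m * sum×² (λ u v → twisted p u v * twisted p u v)
        ≡⟨ cong (m * m *_) (twistedGramSum≡sum×²twisted² p) ⟨
      m * m * twistedGramSum p ∎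

    sum×²[aa]²≡m*m*[N*N] : sum×² (λ u v → (a u * a v) * (a u * a v)) ≡ m * m * (N * N)
    sum×²[aa]²≡m*m*[N*N] = begin
      sum×² (λ u v → (a u * a v) * (a u * a v))
        ≡⟨ sum×²-cong (λ u v → interchange (a u) (a v) (a u) (a v)) ⟩
      sum×² (λ u v → (a u * a u) * (a v * a v))
        ≡⟨ sum×-*-sum× (λ u → a u * a u) (λ v → a v * a v) ⟨
      sum× (λ u → a u * a u) * sum× (λ v → a v * a v)
        ≡⟨ cong₂ _*_ sum×a²≡m*N sum×a²≡m*N ⟩
      (m * N) * (m * N)
        ≡⟨ interchange m N m N ⟩
      m * m * (N * N) ∎

    sum×²[m*twisted*aa]≡m*m*[N*N] : ∀ p →
      sum×² (λ u v → (m * twisted p u v) * (a u * a v)) ≡ m * m * (N * N)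
    sum×²[m*twisted*aa]≡m*m*[N*N] p = begin
      sum×² (λ u v → (m * twisted p u v) * (a u * a v))
        ≡⟨ sum×²-cong (λ u v → *-assoc m (twisted p u v) (a u * a v)) ⟩
      sum×² (λ u v → m * (twisted p u v * (a u * a v)))
        ≡⟨ *-distribˡ-sum×² m (λ u v → twisted p u v * (a u * a v)) ⟨
      m * sum×² (λ u v → twisted p u v * (a u * a v))
        ≡⟨ cong (m *_) (sum×²twisted*aa≡m*N² p) ⟩
      m * (m * (N * N))
        ≡⟨ *-assoc m m (N * N) ⟨
      m * m * (N * N) ∎

    defect : (Fin m → Fin m) → ℕ
    defect p = sum×² λ u v → ∣ m * twisted p u v - a u * a v ∣ * ∣ m * twisted p u v - a u * a v ∣

    m*m*twistedGramSum≡defect+m*m*[N*N] : ∀ p → m * m * twistedGramSum p ≡ defect p + m * m * (N * N)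
    m*m*twistedGramSum≡defect+m*m*[N*N] p = +-cancelʳ-≡ m²N² _ _ (begin
      m * m * twistedGramSum p + m²N²
        ≡⟨ cong₂ _+_ (sum×²[m*twisted]²≡m*m*twistedGramSum p) sum×²[aa]²≡m*m*[N*N] ⟨
      sum×² (λ u v → x u v * x u v) + sum×² (λ u v → y u v * y u v)
        ≡⟨ sum×²-squares x y ⟩
      defect p + 2 * sum×² (λ u v → x u v * y u v)
        ≡⟨ cong (λ t → defect p + 2 * t) (sum×²[m*twisted*aa]≡m*m*[N*N] p) ⟩
      defect p + 2 * m²N²
        ≡⟨ trans (cong (λ t → defect p + (m²N² + t)) (+-identityʳ m²N²))
                 (sym (+-assoc (defect p) m²N² m²N²)) ⟩
      defect p + m²N² + m²N² ∎)
      where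
      m²N² : ℕ
      m²N² = m * m * (N * N)
      x y : Fin r × Fin s → Fin r × Fin s → ℕ
      x u v = m * twisted p u v
      y u v = a u * a v

    0<defect : 2 ≤ m → ∀ {u₀} → a u₀ ≡ 1 → ∀ p → 0 < defect p
    0<defect 2≤m {u₀} au₀≡1 p = <-≤-trans (m≢n⇒0<∣m-n∣*∣m-n∣ m*twisted≢aa) (≤-sum×² _ u₀ u₀)
      where
      m*twisted≢aa : m * twisted p u₀ u₀ ≢ a u₀ * a u₀
      m*twisted≢aa eq = <⇒≢ 2≤m (sym (m*n≡1⇒m≡1 m _ (trans eq (cong₂ _*_ au₀≡1 au₀≡1))))

    N*N<twistedGramSum : 2 ≤ m → ∀ {u₀} → a u₀ ≡ 1 → ∀ p → N * N < twistedGramSum p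
    N*N<twistedGramSum 2≤m au₀≡1 p = *-cancelˡ-< (m * m) (N * N) (twistedGramSum p)
      (subst (m * m * (N * N) <_) (sym (m*m*twistedGramSum≡defect+m*m*[N*N] p))
             (+-monoˡ-< (m * m * (N * N)) (0<defect 2≤m au₀≡1 p)))

vandermonde : ∀ x y d {L} → x < L → ∑[ k < L ] ((x C toℕ k) * (y C (d + toℕ k))) ≡ (x + y) C (d + x)
vandermonde zero y d {suc L} _ = begin
  1 * (y C (d + 0)) + ∑[ k < L ] 0   ≡⟨ cong (1 * (y C (d + 0)) +_) (sum-replicate-zero L) ⟩
  1 * (y C (d + 0)) + 0              ≡⟨ +-identityʳ _ ⟩
  1 * (y C (d + 0))                  ≡⟨ *-identityˡ _ ⟩
  y C (d + 0)                        ∎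
vandermonde (suc x) y d {suc L} (s≤s x<L) = begin
  1 * g 0 + ∑[ k < L ] ((suc x C suc (toℕ k)) * g (suc (toℕ k)))
    ≡⟨ cong (1 * g 0 +_) (sum-cong-≗ {L} λ k →
         trans (cong (_* g (suc (toℕ k))) (sym (nCk+nC[k+1]≡[n+1]C[k+1] x (toℕ k))))
               (*-distribʳ-+ (g (suc (toℕ k))) (x C toℕ k) (x C suc (toℕ k)))) ⟩
  1 * g 0 + ∑[ k < L ] ((x C toℕ k) * g (suc (toℕ k)) + (x C suc (toℕ k)) * g (suc (toℕ k)))
    ≡⟨ cong (1 * g 0 +_) (∑-distrib-+ {L} (λ k → (x C toℕ k) * g (suc (toℕ k)))
                                          (λ k → (x C suc (toℕ k)) * g (suc (toℕ k)))) ⟩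
  1 * g 0 + (A + B)
    ≡⟨ trans (cong (1 * g 0 +_) (+-comm A B)) (sym (+-assoc (1 * g 0) B A)) ⟩
  ∑[ k < suc L ] ((x C toℕ k) * g (toℕ k)) + A
    ≡⟨ cong₂ _+_ (vandermonde x y d (m<n⇒m<1+n x<L))
                 (trans (sum-cong-≗ {L} λ k → cong (λ e → (x C toℕ k) * (y C e)) (+-suc d (toℕ k)))
                        (vandermonde x y (suc d) x<L)) ⟩
  (x + y) C (d + x) + (x + y) C suc (d + x)
    ≡⟨ nCk+nC[k+1]≡[n+1]C[k+1] (x + y) (d + x) ⟩
  suc (x + y) C suc (d + x)
    ≡⟨ cong (suc (x + y) C_) (+-suc d x) ⟨
  suc (x + y) C (d + suc x) ∎
  where
  g : ℕ → ℕ
  g k = y C (d + k)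
  A B : ℕ
  A = ∑[ k < L ] ((x C toℕ k) * g (suc (toℕ k)))
  B = ∑[ k < L ] ((x C suc (toℕ k)) * g (suc (toℕ k)))

vandermonde-upper : ∀ n k l → ∑[ j < suc n ] ((toℕ j C k) * ((n ∸ toℕ j) C l)) ≡ suc n C suc (k + l)
vandermonde-upper zero    zero    zero    = refl
vandermonde-upper zero    zero    (suc l) = refl
vandermonde-upper zero    (suc k) l       = refl
vandermonde-upper (suc n) zero    l       = begin
  1 * (suc n C l) + ∑[ j < suc n ] ((toℕ j C 0) * ((n ∸ toℕ j) C l))
    ≡⟨ cong₂ _+_ (*-identityˡ (suc n C l)) (vandermonde-upper n zero l) ⟩
  suc n C l + suc n C suc l
    ≡⟨ nCk+nC[k+1]≡[n+1]C[k+1] (suc n) l ⟩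
  suc (suc n) C suc l ∎
vandermonde-upper (suc n) (suc k) l = begin
  ∑[ j < suc n ] ((suc (toℕ j) C suc k) * h j)
    ≡⟨ sum-cong-≗ {suc n} (λ j → trans (cong (_* h j) (sym (nCk+nC[k+1]≡[n+1]C[k+1] (toℕ j) k)))
                                       (*-distribʳ-+ (h j) (toℕ j C k) (toℕ j C suc k))) ⟩
  ∑[ j < suc n ] ((toℕ j C k) * h j + (toℕ j C suc k) * h j)
    ≡⟨ ∑-distrib-+ {suc n} (λ j → (toℕ j C k) * h j) (λ j → (toℕ j C suc k) * h j) ⟩
  ∑[ j < suc n ] ((toℕ j C k) * h j) + ∑[ j < suc n ] ((toℕ j C suc k) * h j)
    ≡⟨ cong₂ _+_ (vandermonde-upper n k l) (vandermonde-upper n (suc k) l) ⟩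
  suc n C suc (k + l) + suc n C suc (suc k + l)
    ≡⟨ nCk+nC[k+1]≡[n+1]C[k+1] (suc n) (suc (k + l)) ⟩
  suc (suc n) C suc (suc k + l) ∎
  where
  h : Fin (suc n) → ℕ
  h j = (n ∸ toℕ j) C l

bracketFactor : ∀ n → Fin (suc n) → Fin (suc n) × Fin (suc n) → ℕ
bracketFactor n i (k , l) = (toℕ i C toℕ k) * ((n ∸ toℕ i) C toℕ l)

bracketWeight : ∀ n → Fin (suc n) × Fin (suc n) → ℕ
bracketWeight n (k , l) = suc n C suc (toℕ k + toℕ l)

n∸toℕ<1+n : ∀ {n} (i : Fin (suc n)) → n ∸ toℕ i < suc n
n∸toℕ<1+n {n} i = s≤s (m∸n≤m n (toℕ i))

bracket≡gram : ∀ n i j → bracket (suc n) i j ≡ Gram.gram (bracketFactor n) i j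
bracket≡gram n i j = begin
  ((x + y) C x) * ((x′ + y′) C x′)
    ≡⟨ cong₂ _*_ (vandermonde x y 0 {suc n} (toℕ<n i)) (vandermonde x′ y′ 0 {suc n} (n∸toℕ<1+n i)) ⟨
  ∑[ k < suc n ] ((x C toℕ k) * (y C toℕ k)) * ∑[ l < suc n ] ((x′ C toℕ l) * (y′ C toℕ l))
    ≡⟨ sum-*-sum {suc n} {suc n} (λ k → (x C toℕ k) * (y C toℕ k))
                                 (λ l → (x′ C toℕ l) * (y′ C toℕ l)) ⟩
  ∑[ k < suc n ] ∑[ l < suc n ] (((x C toℕ k) * (y C toℕ k)) * ((x′ C toℕ l) * (y′ C toℕ l)))
    ≡⟨ sum×-cong {suc n} {suc n} (λ (k , l) →
         interchange (x C toℕ k) (y C toℕ k) (x′ C toℕ l) (y′ C toℕ l)) ⟩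
  Gram.gram (bracketFactor n) i j ∎
  where
  x y x′ y′ : ℕ
  x = toℕ i
  y = toℕ j
  x′ = n ∸ toℕ i
  y′ = n ∸ toℕ j

bracketFactor-colSum : ∀ n u → ∑[ j < suc n ] bracketFactor n j u ≡ bracketWeight n u
bracketFactor-colSum n (k , l) = vandermonde-upper n (toℕ k) (toℕ l)

bracketFactor-rowDot : ∀ n i → sum× (λ u → bracketFactor n i u * bracketWeight n u) ≡ (n + suc n) C suc n
bracketFactor-rowDot n i = begin
  ∑[ k < suc n ] ∑[ l < suc n ] (((x C toℕ k) * (x′ C toℕ l)) * w k l)
    ≡⟨ sum-cong-≗ {suc n} (λ k →
         trans (sum-cong-≗ {suc n} λ l → *-assoc (x C toℕ k) (x′ C toℕ l) (w k l))
               (sym (*-distribˡ-sum {suc n} (x C toℕ k) λ l → (x′ C toℕ l) * w k l))) ⟩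
  ∑[ k < suc n ] ((x C toℕ k) * ∑[ l < suc n ] ((x′ C toℕ l) * (suc n C (suc (toℕ k) + toℕ l))))
    ≡⟨ sum-cong-≗ {suc n} (λ k →
         cong ((x C toℕ k) *_) (vandermonde x′ (suc n) (suc (toℕ k)) {suc n} (n∸toℕ<1+n i))) ⟩
  ∑[ k < suc n ] ((x C toℕ k) * ((x′ + suc n) C (suc (toℕ k) + x′)))
    ≡⟨ sum-cong-≗ {suc n} (λ k →
         cong (λ e → (x C toℕ k) * ((x′ + suc n) C suc e)) (+-comm (toℕ k) x′)) ⟩
  ∑[ k < suc n ] ((x C toℕ k) * ((x′ + suc n) C (suc x′ + toℕ k)))
    ≡⟨ vandermonde x (x′ + suc n) (suc x′) {suc n} (toℕ<n i) ⟩
  (x + (x′ + suc n)) C (suc x′ + x)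
    ≡⟨ cong₂ _C_ (trans (sym (+-assoc x x′ (suc n))) (cong (_+ suc n) (m+[n∸m]≡n x≤n)))
                 (cong suc (m∸n+n≡m x≤n)) ⟩
  (n + suc n) C suc n ∎
  where
  x x′ : ℕ
  x = toℕ i
  x′ = n ∸ toℕ i
  x≤n : x ≤ n
  x≤n = toℕ≤pred[n] i
  w : Fin (suc n) → Fin (suc n) → ℕ
  w k l = bracketWeight n (k , l)

bracketWeight-corner : ∀ n → bracketWeight n (zero , fromℕ n) ≡ 1
bracketWeight-corner n = trans (cong (λ t → suc n C suc t) (toℕ-fromℕ n)) (nCn≡1 (suc n))

permSum≡twistedGramSum : ∀ n π → permSum (suc n) π ≡ Gram.twistedGramSum (bracketFactor n) (π ⟨$⟩ʳ_)
permSum≡twistedGramSum n π =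
  trans (Σ[<]≡sum (suc n) λ i → Σ[< suc n ] (term i))
        (sum-cong-≗ λ i → trans (Σ[<]≡sum (suc n) (term i)) (sum-cong-≗ λ j →
           cong₂ _*_ (bracket≡gram n i j) (bracket≡gram n (π ⟨$⟩ʳ i) (π ⟨$⟩ʳ j))))
  where
  term : Fin (suc n) → Fin (suc n) → ℕ
  term i j = bracket (suc n) i j * bracket (suc n) (π ⟨$⟩ʳ i) (π ⟨$⟩ʳ j)

central-binomial : ∀ n → (n + suc n) C suc n ≡ (2 * suc n ∸ 1) C (suc n ∸ 1)
central-binomial n = begin
  (n + suc n) C suc n                ≡⟨ nCk≡nC[n∸k] (m≤n+m (suc n) n) ⟩
  (n + suc n) C (n + suc n ∸ suc n)  ≡⟨ cong ((n + suc n) C_) (m+n∸n≡m n (suc n)) ⟩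
  (n + suc n) C n                    ≡⟨ cong (λ t → (n + t) C n) (+-identityʳ (suc n)) ⟨
  (2 * suc n ∸ 1) C (suc n ∸ 1)      ∎

lemma4p3 : (m : ℕ) → 2 ≤ m → (π : Permutation′ m) →
    ((2 * m ∸ 1) C (m ∸ 1)) * ((2 * m ∸ 1) C (m ∸ 1)) < permSum m π
lemma4p3 (suc n) 2≤m π =
  subst₂ _<_ (cong (λ c → c * c) (central-binomial n)) (sym (permSum≡twistedGramSum n π))
    (Gram.N*N<twistedGramSum (bracketFactor n) (bracketWeight n) ((n + suc n) C suc n)
      (bracketFactor-colSum n) (bracketFactor-rowDot n)
      2≤m {zero , fromℕ n} (bracketWeight-corner n) (π ⟨$⟩ʳ_))
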